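{- Let $G$ be the join $G_1\ast G_2$ of two graphs $G_1$ and $G_2$. Then $G$ is $1$-perfectly orientable if and only if one of the following holds: (1) $G_1$ is complete and $G_2$ is $1$-perfectly orientable, or $G_2$ is complete and $G_1$ is $1$-perfectly orientable; (2) each of $G_1$ and $G_2$ is a co-bipartite $1$-perfectly orientable graph. In particular, the class of co-bipartite $1$-perfectly orientable graphs is closed under join.
   Context: All graphs are finite and simple. The join $G_1\ast G_2$ is obtained from the disjoint union of $G_1$ and $G_2$ by adding all edges between a vertex of $G_1$ and a vertex of $G_2$. A graph is co-bipartite if its complement is bipartite. An orientation of a graph $G$ is $1$-perfect if for every vertex $v$, its out-neighborhood is a clique in $G$; $G$ is $1$-perfectly orientable if it admits a $1$-perfect orientation. -}

module Defs where

open import Data.Nat using (ℕ; _+_)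
open import Data.Fin using (Fin; splitAt; _≟_)
open import Relation.Nullary using (yes; no)
open import Data.Empty using (⊥-elim)
open import Data.Bool using (Bool; true; false; not)
open import Data.Sum using (_⊎_; inj₁; inj₂)
open import Data.Product using (_×_; Σ; ∃)
open import Relation.Binary.PropositionalEquality using (_≡_; _≢_; refl; cong) renaming (sym to ≡-sym)

record Graph (n : ℕ) : Set where
  field
    adj    : Fin n → Fin n → Bool
    sym    : ∀ u v → adj u v ≡ adj v u
    irrefl : ∀ v → adj v v ≡ false
open Graph public

Adj : ∀ {n} → Graph n → Fin n → Fin n → Set
Adj G u v = adj G u v ≡ true

joinAdj : ∀ {m n} → Graph m → Graph n → Fin (m + n) → Fin (m + n) → Bool
joinAdj {m} G₁ G₂ u v with splitAt m u | splitAt m v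
... | inj₁ a | inj₁ b = adj G₁ a b
... | inj₁ _ | inj₂ _ = true
... | inj₂ _ | inj₁ _ = true
... | inj₂ a | inj₂ b = adj G₂ a b

joinSym : ∀ {m n} (G₁ : Graph m) (G₂ : Graph n) u v →
          joinAdj G₁ G₂ u v ≡ joinAdj G₁ G₂ v u
joinSym {m} G₁ G₂ u v with splitAt m u | splitAt m v
... | inj₁ a | inj₁ b = sym G₁ a b
... | inj₁ _ | inj₂ _ = refl
... | inj₂ _ | inj₁ _ = refl
... | inj₂ a | inj₂ b = sym G₂ a b

joinIrrefl : ∀ {m n} (G₁ : Graph m) (G₂ : Graph n) v → joinAdj G₁ G₂ v v ≡ false
joinIrrefl {m} G₁ G₂ v with splitAt m v
... | inj₁ a = irrefl G₁ a
... | inj₂ a = irrefl G₂ a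

_∗_ : ∀ {m n} → Graph m → Graph n → Graph (m + n)
G₁ ∗ G₂ = record { adj = joinAdj G₁ G₂ ; sym = joinSym G₁ G₂ ; irrefl = joinIrrefl G₁ G₂ }

record Orientation {n} (G : Graph n) : Set where
  field
    arc      : Fin n → Fin n → Bool
    arc⇒adj  : ∀ u v → arc u v ≡ true → Adj G u v
    adj⇒arc  : ∀ u v → Adj G u v → arc u v ≡ true ⊎ arc v u ≡ true
    antisym  : ∀ u v → arc u v ≡ true → arc v u ≡ false
open Orientation public

Is1Perfect : ∀ {n} {G : Graph n} → Orientation G → Set
Is1Perfect {n} {G} D =
  ∀ v u w → arc D v u ≡ true → arc D v w ≡ true → u ≢ w → Adj G u w

OnePerfectlyOrientable : ∀ {n} → Graph n → Set
OnePerfectlyOrientable G = Σ (Orientation G) Is1Perfect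

Complete : ∀ {n} → Graph n → Set
Complete G = ∀ u v → u ≢ v → Adj G u v

Bipartite : ∀ {n} → Graph n → Set
Bipartite {n} G = ∃ λ (c : Fin n → Bool) → ∀ u v → Adj G u v → c u ≢ c v

complementAdj : ∀ {n} → Graph n → Fin n → Fin n → Bool
complementAdj G u v with u ≟ v
... | yes _ = false
... | no _  = not (adj G u v)

complementSym : ∀ {n} (G : Graph n) u v → complementAdj G u v ≡ complementAdj G v u
complementSym G u v with u ≟ v | v ≟ u
... | yes _  | yes _  = refl
... | yes p  | no ¬q  = ⊥-elim (¬q (≡-sym p))
... | no ¬p  | yes q  = ⊥-elim (¬p (≡-sym q))
... | no _   | no _   = cong not (sym G u v)

complementIrrefl : ∀ {n} (G : Graph n) v → complementAdj G v v ≡ false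
complementIrrefl G v with v ≟ v
... | yes _ = refl
... | no ¬p = ⊥-elim (¬p refl)

complement : ∀ {n} → Graph n → Graph n
complement G = record { adj = complementAdj G ; sym = complementSym G ; irrefl = complementIrrefl G }

CoBipartite : ∀ {n} → Graph n → Set
CoBipartite G = Bipartite (complement G)

-- A 1-perfect orientation of G₁ ∗ G₂ restricts to one of each side. If both sides have a
-- non-edge, say u, w in G₂, then every vertex of G₁ is a common neighbour of u and w, hence
-- (by 1-perfectness at that vertex) an out-neighbour of u or of w; these two out-neighbourhoods
-- are cliques covering G₁, so G₁ is co-bipartite. Conversely, combine 1-perfect orientations
-- of the sides with arcs across chosen so that each vertex's out-neighbours on the other side
-- form a clique: all arcs point into a complete side, or, for two co-bipartite sides, a → x
-- exactly when a and x have the same colour.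
module Submission where

open import Defs
open import Data.Bool using (Bool; true; false; not)
open import Data.Bool.Properties using (¬-not) renaming (_≟_ to _≟ᵇ_)
open import Data.Empty using (⊥)
open import Data.Fin using (Fin; splitAt; join; _↑ˡ_; _↑ʳ_; _≟_)
open import Data.Fin.Properties
  using (splitAt-↑ˡ; splitAt-↑ʳ; join-splitAt; ↑ˡ-injective; ↑ʳ-injective; _<?_; <-cmp; <-asym; <⇒≢; all?; ¬∀⟶∃¬)
open import Data.Nat using (ℕ; _+_)
open import Data.Product using (_×_; _,_; ∃; ∃₂; proj₁)
open import Data.Sum using (_⊎_; inj₁; inj₂; [_,_]′; swap) renaming (map to ⊎-map)
open import Data.Unit using (⊤; tt)
open import Function using (_∘_)
open import Function.Bundles using (_⇔_; mk⇔; Equivalence)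
open Equivalence using (to; from)
open import Relation.Binary.Definitions using (tri<; tri≈; tri>)
open import Relation.Binary.PropositionalEquality using (_≡_; _≢_; refl; cong; subst; trans) renaming (sym to ≡-sym)
open import Relation.Nullary using (¬_; Dec; yes; no; does; ¬?; _→-dec_; contradiction)
open import Relation.Nullary.Decidable using (dec-true; dec-false)

private variable
  k m n N : ℕ

does-true⇒ : {A : Set} (a? : Dec A) → does a? ≡ true → A
does-true⇒ (yes a) _  = a
does-true⇒ (no _)  ()

does⊎does-¬? : {A : Set} (a? : Dec A) → does a? ≡ true ⊎ does (¬? a?) ≡ true
does⊎does-¬? (yes _) = inj₁ refl
does⊎does-¬? (no _)  = inj₂ refl

true≢false : true ≢ false
true≢false ()

complement-adj⇒ : (G : Graph k) {x y : Fin k} → Adj (complement G) x y → x ≢ y × adj G x y ≡ false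
complement-adj⇒ G {x} {y} h with x ≟ y
... | yes _ = contradiction (≡-sym h) true≢false
... | no x≢y with adj G x y
...   | false = x≢y , refl
...   | true  = contradiction (≡-sym h) true≢false

complement-adj⇐ : (G : Graph k) {x y : Fin k} → x ≢ y → adj G x y ≡ false → Adj (complement G) x y
complement-adj⇐ G {x} {y} x≢y ¬xy with x ≟ y
... | yes x≡y = contradiction x≡y x≢y
... | no _ rewrite ¬xy = refl

CliqueClasses : Graph k → (Fin k → Bool) → Set
CliqueClasses {k} G c = ∀ (a b : Fin k) → a ≢ b → c a ≡ c b → Adj G a b

coBipartite⇔cliqueClasses : (G : Graph k) → CoBipartite G ⇔ ∃ (CliqueClasses G)
coBipartite⇔cliqueClasses G = mk⇔ proper⇒classes classes⇒proper
  where
  proper⇒classes : CoBipartite G → ∃ (CliqueClasses G)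
  proper⇒classes (c , proper) = c , classes
    where
    classes : CliqueClasses G c
    classes a b a≢b same with adj G a b in ab
    ... | true  = refl
    ... | false = contradiction same (proper a b (complement-adj⇐ G a≢b ab))
  classes⇒proper : ∃ (CliqueClasses G) → CoBipartite G
  classes⇒proper (c , classes) = c , λ a b h same →
    let a≢b , ¬ab = complement-adj⇒ G h in true≢false (trans (≡-sym (classes a b a≢b same)) ¬ab)

NonEdge : Graph k → Set
NonEdge {k} G = ∃₂ λ (u w : Fin k) → u ≢ w × adj G u w ≡ false

adjacent-if-distinct? : (G : Graph k) (u w : Fin k) → Dec (u ≢ w → Adj G u w)
adjacent-if-distinct? G u w = ¬? (u ≟ w) →-dec (adj G u w ≟ᵇ true)

complete⊎nonEdge : (G : Graph k) → Complete G ⊎ NonEdge G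
complete⊎nonEdge {k} G with all? (all? ∘ adjacent-if-distinct? G)
... | yes complete = inj₁ complete
... | no ¬complete
  with u , ¬completeᵤ ← ¬∀⟶∃¬ k _ (all? ∘ adjacent-if-distinct? G) ¬complete
  with w , ¬uw ← ¬∀⟶∃¬ k _ (adjacent-if-distinct? G u) ¬completeᵤ
  = inj₂ (u , w , (λ u≡w → ¬uw (λ u≢w → contradiction u≡w u≢w)) , ¬-not (λ uw → ¬uw (λ _ → uw)))

complete⇒onePerfectlyOrientable : (G : Graph k) → Complete G → OnePerfectlyOrientable G
complete⇒onePerfectlyOrientable G complete = D , λ _ u w _ _ u≢w → complete u w u≢w
  where
  adj⇒< : ∀ a b → Adj G a b → does (a <? b) ≡ true ⊎ does (b <? a) ≡ true
  adj⇒< a b ab with <-cmp a b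
  ... | tri< a<b _ _ = inj₁ (dec-true (a <? b) a<b)
  ... | tri≈ _ refl _ = contradiction (trans (≡-sym ab) (irrefl G a)) true≢false
  ... | tri> _ _ b<a = inj₂ (dec-true (b <? a) b<a)
  D : Orientation G
  D = record
    { arc     = λ a b → does (a <? b)
    ; arc⇒adj = λ a b a<b → complete a b (<⇒≢ (does-true⇒ (a <? b) a<b))
    ; adj⇒arc = adj⇒<
    ; antisym = λ a b a<b → dec-false (b <? a) (<-asym (does-true⇒ (a <? b) a<b))
    }

record InducedEmbedding (G : Graph k) (H : Graph N) : Set where
  field
    embed           : Fin k → Fin N
    embed-injective : ∀ a b → embed a ≡ embed b → a ≡ b
    embed-adj       : ∀ a b → adj H (embed a) (embed b) ≡ adj G a b

module _ {G : Graph k} {H : Graph N} (e : InducedEmbedding G H) where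
  open InducedEmbedding e

  out-neighbours-clique : ((D , _) : OnePerfectlyOrientable H) (v : Fin N) {a b : Fin k} →
    arc D v (embed a) ≡ true → arc D v (embed b) ≡ true → a ≢ b → Adj G a b
  out-neighbours-clique (D , D-1perfect) v {a} {b} va vb a≢b =
    trans (≡-sym (embed-adj a b)) (D-1perfect v _ _ va vb (a≢b ∘ embed-injective a b))

  onePerfectlyOrientable-induced : OnePerfectlyOrientable H → OnePerfectlyOrientable G
  onePerfectlyOrientable-induced po@(D , _) = D′ , λ v _ _ → out-neighbours-clique po (embed v)
    where
    D′ : Orientation G
    D′ = record
      { arc     = λ a b → arc D (embed a) (embed b)
      ; arc⇒adj = λ a b ab → trans (≡-sym (embed-adj a b)) (arc⇒adj D _ _ ab)
      ; adj⇒arc = λ a b ab → adj⇒arc D _ _ (trans (embed-adj a b) ab)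
      ; antisym = λ a b → antisym D _ _
      }

  -- Colour a by whether u → a: if neither u → a nor w → a, then a → u and a → w,
  -- and 1-perfectness at a would make u and w adjacent.
  coBipartite-common-neighbours : OnePerfectlyOrientable H → {u w : Fin N} →
    u ≢ w → adj H u w ≡ false →
    (∀ a → Adj H u (embed a)) → (∀ a → Adj H w (embed a)) → CoBipartite G
  coBipartite-common-neighbours po@(D , D-1perfect) {u} {w} u≢w ¬uw u~ w~ =
    from (coBipartite⇔cliqueClasses G) (colour , classes)
    where
    colour : Fin k → Bool
    colour a = arc D u (embed a)
    w⇀ : ∀ a → colour a ≡ false → arc D w (embed a) ≡ true
    w⇀ a ¬u⇀a with adj⇒arc D u (embed a) (u~ a)
    ... | inj₁ u⇀a = contradiction (trans (≡-sym u⇀a) ¬u⇀a) true≢false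
    ... | inj₂ a⇀u with adj⇒arc D w (embed a) (w~ a)
    ...   | inj₁ w⇀a = w⇀a
    ...   | inj₂ a⇀w = contradiction (trans (≡-sym (D-1perfect _ u w a⇀u a⇀w u≢w)) ¬uw) true≢false
    classes : CliqueClasses G colour
    classes a b a≢b same with colour a in ca
    ... | true  = out-neighbours-clique po u ca (≡-sym same) a≢b
    ... | false = out-neighbours-clique po w (w⇀ a ca) (w⇀ b (≡-sym same)) a≢b

data SplitView (m n : ℕ) : Fin (m + n) → Set where
  left  : (a : Fin m) → SplitView m n (a ↑ˡ n)
  right : (x : Fin n) → SplitView m n (m ↑ʳ x)

splitView : ∀ m n (u : Fin (m + n)) → SplitView m n u
splitView m n u = subst (SplitView m n) (join-splitAt m n u) (fromSplit (splitAt m u))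
  where
  fromSplit : (s : Fin m ⊎ Fin n) → SplitView m n (join m n s)
  fromSplit (inj₁ a) = left a
  fromSplit (inj₂ x) = right x

case-splitAt-↑ˡ : {A : Set} (f : Fin m → A) (g : Fin n → A) (a : Fin m) →
  [ f , g ]′ (splitAt m (a ↑ˡ n)) ≡ f a
case-splitAt-↑ˡ {m} {n} f g a = cong [ f , g ]′ (splitAt-↑ˡ m a n)

case-splitAt-↑ʳ : {A : Set} (f : Fin m → A) (g : Fin n → A) (x : Fin n) →
  [ f , g ]′ (splitAt m (m ↑ʳ x)) ≡ g x
case-splitAt-↑ʳ {m} {n} f g x = cong [ f , g ]′ (splitAt-↑ʳ m n x)

module _ (G₁ : Graph m) (G₂ : Graph n) where

  ∗-adj-ˡˡ : ∀ a b → adj (G₁ ∗ G₂) (a ↑ˡ n) (b ↑ˡ n) ≡ adj G₁ a b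
  ∗-adj-ˡˡ a b rewrite splitAt-↑ˡ m a n | splitAt-↑ˡ m b n = refl

  ∗-adj-ˡʳ : ∀ a x → Adj (G₁ ∗ G₂) (a ↑ˡ n) (m ↑ʳ x)
  ∗-adj-ˡʳ a x rewrite splitAt-↑ˡ m a n | splitAt-↑ʳ m n x = refl

  ∗-adj-ʳˡ : ∀ x a → Adj (G₁ ∗ G₂) (m ↑ʳ x) (a ↑ˡ n)
  ∗-adj-ʳˡ x a rewrite splitAt-↑ʳ m n x | splitAt-↑ˡ m a n = refl

  ∗-adj-ʳʳ : ∀ x y → adj (G₁ ∗ G₂) (m ↑ʳ x) (m ↑ʳ y) ≡ adj G₂ x y
  ∗-adj-ʳʳ x y rewrite splitAt-↑ʳ m n x | splitAt-↑ʳ m n y = refl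

  ↑ˡ-inducedEmbedding : InducedEmbedding G₁ (G₁ ∗ G₂)
  ↑ˡ-inducedEmbedding = record
    { embed = _↑ˡ n ; embed-injective = ↑ˡ-injective n ; embed-adj = ∗-adj-ˡˡ }

  ↑ʳ-inducedEmbedding : InducedEmbedding G₂ (G₁ ∗ G₂)
  ↑ʳ-inducedEmbedding = record
    { embed = m ↑ʳ_ ; embed-injective = ↑ʳ-injective m ; embed-adj = ∗-adj-ʳʳ }

  ∗-cliqueClasses : ∀ {c₁ c₂} → CliqueClasses G₁ c₁ → CliqueClasses G₂ c₂ →
    CliqueClasses (G₁ ∗ G₂) (λ u → [ c₁ , c₂ ]′ (splitAt m u))
  ∗-cliqueClasses {c₁} {c₂} classes₁ classes₂ u v u≢v same with splitView m n u | splitView m n v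
  ... | left a  | left b  = trans (∗-adj-ˡˡ a b) (classes₁ a b (u≢v ∘ cong (_↑ˡ n)) c₁a≡c₁b)
    where
    c₁a≡c₁b : c₁ a ≡ c₁ b
    c₁a≡c₁b = trans (≡-sym (case-splitAt-↑ˡ c₁ c₂ a)) (trans same (case-splitAt-↑ˡ c₁ c₂ b))
  ... | left a  | right y = ∗-adj-ˡʳ a y
  ... | right x | left b  = ∗-adj-ʳˡ x b
  ... | right x | right y = trans (∗-adj-ʳʳ x y) (classes₂ x y (u≢v ∘ cong (m ↑ʳ_)) c₂x≡c₂y)
    where
    c₂x≡c₂y : c₂ x ≡ c₂ y
    c₂x≡c₂y = trans (≡-sym (case-splitAt-↑ʳ c₁ c₂ x)) (trans same (case-splitAt-↑ʳ c₁ c₂ y))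

  ∗-coBipartite : CoBipartite G₁ → CoBipartite G₂ → CoBipartite (G₁ ∗ G₂)
  ∗-coBipartite cob₁ cob₂
    with _ , classes₁ ← to (coBipartite⇔cliqueClasses G₁) cob₁
    with _ , classes₂ ← to (coBipartite⇔cliqueClasses G₂) cob₂
    = from (coBipartite⇔cliqueClasses (G₁ ∗ G₂)) (_ , ∗-cliqueClasses classes₁ classes₂)

  module JoinOrientation
    (D₁ : Orientation G₁) (D₁-1perfect : Is1Perfect D₁)
    (D₂ : Orientation G₂) (D₂-1perfect : Is1Perfect D₂)
    (_⇀_ : Fin m → Fin n → Set) (_⇀?_ : ∀ a x → Dec (a ⇀ x))
    (out-clique : ∀ {a x y} → a ⇀ x → a ⇀ y → x ≢ y → Adj G₂ x y)
    (in-clique : ∀ {a b x} → ¬ a ⇀ x → ¬ b ⇀ x → a ≢ b → Adj G₁ a b)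
    where

    arc∗ : Fin (m + n) → Fin (m + n) → Bool
    arc∗ u v with splitAt m u | splitAt m v
    ... | inj₁ a | inj₁ b = arc D₁ a b
    ... | inj₁ a | inj₂ x = does (a ⇀? x)
    ... | inj₂ x | inj₁ a = does (¬? (a ⇀? x))
    ... | inj₂ x | inj₂ y = arc D₂ x y

    arc∗-ˡˡ : ∀ a b → arc∗ (a ↑ˡ n) (b ↑ˡ n) ≡ arc D₁ a b
    arc∗-ˡˡ a b rewrite splitAt-↑ˡ m a n | splitAt-↑ˡ m b n = refl

    arc∗-ˡʳ : ∀ a x → arc∗ (a ↑ˡ n) (m ↑ʳ x) ≡ does (a ⇀? x)
    arc∗-ˡʳ a x rewrite splitAt-↑ˡ m a n | splitAt-↑ʳ m n x = refl

    arc∗-ʳˡ : ∀ x a → arc∗ (m ↑ʳ x) (a ↑ˡ n) ≡ does (¬? (a ⇀? x))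
    arc∗-ʳˡ x a rewrite splitAt-↑ʳ m n x | splitAt-↑ˡ m a n = refl

    arc∗-ʳʳ : ∀ x y → arc∗ (m ↑ʳ x) (m ↑ʳ y) ≡ arc D₂ x y
    arc∗-ʳʳ x y rewrite splitAt-↑ʳ m n x | splitAt-↑ʳ m n y = refl

    arc∗⇒adj : ∀ u v → arc∗ u v ≡ true → Adj (G₁ ∗ G₂) u v
    arc∗⇒adj u v uv with splitView m n u | splitView m n v
    ... | left a  | left b  = trans (∗-adj-ˡˡ a b) (arc⇒adj D₁ a b (trans (≡-sym (arc∗-ˡˡ a b)) uv))
    ... | left a  | right y = ∗-adj-ˡʳ a y
    ... | right x | left b  = ∗-adj-ʳˡ x b
    ... | right x | right y = trans (∗-adj-ʳʳ x y) (arc⇒adj D₂ x y (trans (≡-sym (arc∗-ʳʳ x y)) uv))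

    cross-arc : ∀ a x → arc∗ (a ↑ˡ n) (m ↑ʳ x) ≡ true ⊎ arc∗ (m ↑ʳ x) (a ↑ˡ n) ≡ true
    cross-arc a x = ⊎-map (trans (arc∗-ˡʳ a x)) (trans (arc∗-ʳˡ x a)) (does⊎does-¬? (a ⇀? x))

    adj⇒arc∗ : ∀ u v → Adj (G₁ ∗ G₂) u v → arc∗ u v ≡ true ⊎ arc∗ v u ≡ true
    adj⇒arc∗ u v uv with splitView m n u | splitView m n v
    ... | left a  | left b  = ⊎-map (trans (arc∗-ˡˡ a b)) (trans (arc∗-ˡˡ b a))
                                (adj⇒arc D₁ a b (trans (≡-sym (∗-adj-ˡˡ a b)) uv))
    ... | left a  | right y = cross-arc a y
    ... | right x | left b  = swap (cross-arc b x)
    ... | right x | right y = ⊎-map (trans (arc∗-ʳʳ x y)) (trans (arc∗-ʳʳ y x))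
                                (adj⇒arc D₂ x y (trans (≡-sym (∗-adj-ʳʳ x y)) uv))

    arc∗-antisym : ∀ u v → arc∗ u v ≡ true → arc∗ v u ≡ false
    arc∗-antisym u v uv with splitView m n u | splitView m n v
    ... | left a  | left b  = trans (arc∗-ˡˡ b a) (antisym D₁ a b (trans (≡-sym (arc∗-ˡˡ a b)) uv))
    ... | left a  | right y = trans (arc∗-ʳˡ y a) (cong not (trans (≡-sym (arc∗-ˡʳ a y)) uv))
    ... | right x | left b  =
      trans (arc∗-ˡʳ b x) (dec-false (b ⇀? x) (does-true⇒ (¬? (b ⇀? x)) (trans (≡-sym (arc∗-ʳˡ x b)) uv)))
    ... | right x | right y = trans (arc∗-ʳʳ y x) (antisym D₂ x y (trans (≡-sym (arc∗-ʳʳ x y)) uv))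

    orientation : Orientation (G₁ ∗ G₂)
    orientation = record { arc = arc∗ ; arc⇒adj = arc∗⇒adj ; adj⇒arc = adj⇒arc∗ ; antisym = arc∗-antisym }

    ⇀-of-arc : ∀ a x → arc∗ (a ↑ˡ n) (m ↑ʳ x) ≡ true → a ⇀ x
    ⇀-of-arc a x = does-true⇒ (a ⇀? x) ∘ trans (≡-sym (arc∗-ˡʳ a x))

    ¬⇀-of-arc : ∀ x a → arc∗ (m ↑ʳ x) (a ↑ˡ n) ≡ true → ¬ a ⇀ x
    ¬⇀-of-arc x a = does-true⇒ (¬? (a ⇀? x)) ∘ trans (≡-sym (arc∗-ʳˡ x a))

    orientation-1perfect : Is1Perfect orientation
    orientation-1perfect v u w vu vw u≢w with splitView m n v | splitView m n u | splitView m n w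
    ... | left a  | left b  | left c  = trans (∗-adj-ˡˡ b c)
      (D₁-1perfect a b c (trans (≡-sym (arc∗-ˡˡ a b)) vu) (trans (≡-sym (arc∗-ˡˡ a c)) vw) (u≢w ∘ cong (_↑ˡ n)))
    ... | left a  | right x | right y = trans (∗-adj-ʳʳ x y)
      (out-clique (⇀-of-arc a x vu) (⇀-of-arc a y vw) (u≢w ∘ cong (m ↑ʳ_)))
    ... | right x | left a  | left b  = trans (∗-adj-ˡˡ a b)
      (in-clique (¬⇀-of-arc x a vu) (¬⇀-of-arc x b vw) (u≢w ∘ cong (_↑ˡ n)))
    ... | right x | right y | right z = trans (∗-adj-ʳʳ y z)
      (D₂-1perfect x y z (trans (≡-sym (arc∗-ʳʳ x y)) vu) (trans (≡-sym (arc∗-ʳʳ x z)) vw) (u≢w ∘ cong (m ↑ʳ_)))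
    ... | _ | left a  | right y = ∗-adj-ˡʳ a y
    ... | _ | right x | left b  = ∗-adj-ʳˡ x b

    onePerfectlyOrientable : OnePerfectlyOrientable (G₁ ∗ G₂)
    onePerfectlyOrientable = orientation , orientation-1perfect

  ∗-onePerfectlyOrientable-completeˡ :
    Complete G₁ → OnePerfectlyOrientable G₂ → OnePerfectlyOrientable (G₁ ∗ G₂)
  ∗-onePerfectlyOrientable-completeˡ complete₁ (D₂ , D₂-1perfect)
    with D₁ , D₁-1perfect ← complete⇒onePerfectlyOrientable G₁ complete₁
    = JoinOrientation.onePerfectlyOrientable D₁ D₁-1perfect D₂ D₂-1perfect
        (λ _ _ → ⊥) (λ _ _ → no λ ()) (λ ()) (λ _ _ → complete₁ _ _)

  ∗-onePerfectlyOrientable-completeʳ :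
    Complete G₂ → OnePerfectlyOrientable G₁ → OnePerfectlyOrientable (G₁ ∗ G₂)
  ∗-onePerfectlyOrientable-completeʳ complete₂ (D₁ , D₁-1perfect)
    with D₂ , D₂-1perfect ← complete⇒onePerfectlyOrientable G₂ complete₂
    = JoinOrientation.onePerfectlyOrientable D₁ D₁-1perfect D₂ D₂-1perfect
        (λ _ _ → ⊤) (λ _ _ → yes tt) (λ _ _ → complete₂ _ _) (λ ¬⇀ _ → contradiction tt ¬⇀)

  -- Orient a → x iff a and x have the same colour: then the out-neighbours of a in G₂,
  -- and those of x in G₁, form a single colour class, hence a clique.
  ∗-onePerfectlyOrientable-coBipartite : CoBipartite G₁ × OnePerfectlyOrientable G₁ →
    CoBipartite G₂ × OnePerfectlyOrientable G₂ → OnePerfectlyOrientable (G₁ ∗ G₂)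
  ∗-onePerfectlyOrientable-coBipartite (cob₁ , D₁ , D₁-1perfect) (cob₂ , D₂ , D₂-1perfect)
    with c₁ , classes₁ ← to (coBipartite⇔cliqueClasses G₁) cob₁
    with c₂ , classes₂ ← to (coBipartite⇔cliqueClasses G₂) cob₂
    = JoinOrientation.onePerfectlyOrientable D₁ D₁-1perfect D₂ D₂-1perfect
        (λ a x → c₁ a ≡ c₂ x) (λ a x → c₁ a ≟ᵇ c₂ x)
        (λ a⇀x a⇀y x≢y → classes₂ _ _ x≢y (trans (≡-sym a⇀x) a⇀y))
        (λ ¬a⇀x ¬b⇀x a≢b → classes₁ _ _ a≢b (trans (¬-not ¬a⇀x) (≡-sym (¬-not ¬b⇀x))))

  ∗-coBipartiteˡ : OnePerfectlyOrientable (G₁ ∗ G₂) → NonEdge G₂ → CoBipartite G₁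
  ∗-coBipartiteˡ po (x , y , x≢y , ¬xy) =
    coBipartite-common-neighbours ↑ˡ-inducedEmbedding po
      (x≢y ∘ ↑ʳ-injective m x y) (trans (∗-adj-ʳʳ x y) ¬xy) (∗-adj-ʳˡ x) (∗-adj-ʳˡ y)

  ∗-coBipartiteʳ : OnePerfectlyOrientable (G₁ ∗ G₂) → NonEdge G₁ → CoBipartite G₂
  ∗-coBipartiteʳ po (a , b , a≢b , ¬ab) =
    coBipartite-common-neighbours ↑ʳ-inducedEmbedding po
      (a≢b ∘ ↑ˡ-injective n a b) (trans (∗-adj-ˡˡ a b) ¬ab) (∗-adj-ˡʳ a) (∗-adj-ˡʳ b)

  OrientableJoinCondition : Set
  OrientableJoinCondition =
    ((Complete G₁ × OnePerfectlyOrientable G₂) ⊎ (Complete G₂ × OnePerfectlyOrientable G₁))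
    ⊎ ((CoBipartite G₁ × OnePerfectlyOrientable G₁) × (CoBipartite G₂ × OnePerfectlyOrientable G₂))

  ∗-onePerfectlyOrientableˡ : OnePerfectlyOrientable (G₁ ∗ G₂) → OnePerfectlyOrientable G₁
  ∗-onePerfectlyOrientableˡ = onePerfectlyOrientable-induced ↑ˡ-inducedEmbedding

  ∗-onePerfectlyOrientableʳ : OnePerfectlyOrientable (G₁ ∗ G₂) → OnePerfectlyOrientable G₂
  ∗-onePerfectlyOrientableʳ = onePerfectlyOrientable-induced ↑ʳ-inducedEmbedding

  ∗-onePerfectlyOrientable⇒ : OnePerfectlyOrientable (G₁ ∗ G₂) → OrientableJoinCondition
  ∗-onePerfectlyOrientable⇒ po with complete⊎nonEdge G₁ | complete⊎nonEdge G₂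
  ... | inj₁ complete₁ | _              = inj₁ (inj₁ (complete₁ , ∗-onePerfectlyOrientableʳ po))
  ... | inj₂ _         | inj₁ complete₂ = inj₁ (inj₂ (complete₂ , ∗-onePerfectlyOrientableˡ po))
  ... | inj₂ nonEdge₁  | inj₂ nonEdge₂  =
    inj₂ ( (∗-coBipartiteˡ po nonEdge₂ , ∗-onePerfectlyOrientableˡ po)
         , (∗-coBipartiteʳ po nonEdge₁ , ∗-onePerfectlyOrientableʳ po))

  ∗-onePerfectlyOrientable⇐ : OrientableJoinCondition → OnePerfectlyOrientable (G₁ ∗ G₂)
  ∗-onePerfectlyOrientable⇐ (inj₁ (inj₁ (complete₁ , po₂))) = ∗-onePerfectlyOrientable-completeˡ complete₁ po₂
  ∗-onePerfectlyOrientable⇐ (inj₁ (inj₂ (complete₂ , po₁))) = ∗-onePerfectlyOrientable-completeʳ complete₂ po₁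
  ∗-onePerfectlyOrientable⇐ (inj₂ (h₁ , h₂))                = ∗-onePerfectlyOrientable-coBipartite h₁ h₂

theorem7 : ∀ {m n} (G₁ : Graph m) (G₂ : Graph n) →
    (OnePerfectlyOrientable (G₁ ∗ G₂) ⇔
      (((Complete G₁ × OnePerfectlyOrientable G₂) ⊎ (Complete G₂ × OnePerfectlyOrientable G₁))
       ⊎ ((CoBipartite G₁ × OnePerfectlyOrientable G₁) × (CoBipartite G₂ × OnePerfectlyOrientable G₂))))
    × ((CoBipartite G₁ × OnePerfectlyOrientable G₁) → (CoBipartite G₂ × OnePerfectlyOrientable G₂) →
       CoBipartite (G₁ ∗ G₂) × OnePerfectlyOrientable (G₁ ∗ G₂))
theorem7 G₁ G₂ =
  mk⇔ (∗-onePerfectlyOrientable⇒ G₁ G₂) (∗-onePerfectlyOrientable⇐ G₁ G₂) ,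
  λ h₁ h₂ → ∗-coBipartite G₁ G₂ (proj₁ h₁) (proj₁ h₂) , ∗-onePerfectlyOrientable-coBipartite G₁ G₂ h₁ h₂
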